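{- Let $a, b$ be relatively prime positive integers such that $\frac{6}{5} < \frac{a}{b} < \frac{5}{4}$ and $\frac{a}{b} \notin \{\frac{11}{9}, \frac{17}{14}\}$. Then the $a$-uniform morphism $\varphi$ on $\mathbb{Z}_{\geq 0}$ defined by $\varphi(n) = 0^{6 a-7 b-1} \, 1 \, 0^{ -3 a+4 b-1} \, 1 \, 0^{ -8 a+10 b-1} \, 1 \, 0^{6 a-7 b-1} \, (n+1)$ locates words of length $a$ and is $\frac{a}{b}$-power-free.
   Context: Words are indexed from position $0$; a factor is a contiguous subword; $c^m$ denotes $m$ copies of the letter $c$. For relatively prime positive integers $a,b$ and a nonempty word $v$ whose length is divisible by $b$, define $v^{a/b} = v^{\lfloor a/b \rfloor} v_0 v_1 \cdots v_{t-1}$, where $t = |v|\,(a/b - \lfloor a/b\rfloor)$; such a word is called an $\frac{a}{b}$-power. A word is $\frac{a}{b}$-power-free if none of its factors is an $\frac{a}{b}$-power. A morphism $\varphi$ on an alphabet $\Sigma$ is a map $\Sigma \to \Sigma^*$, extended to words by concatenation; it is $k$-uniform if all images have length $k$. A morphism is $\frac{a}{b}$-power-free if $\varphi(w)$ is $\frac{a}{b}$-power-free for every finite $\frac{a}{b}$-power-free word $w$. A $k$-uniform morphism $\varphi$ on $\Sigma$ locates words of length $\ell$ if for each word $x$ of length $\ell$ there is an integer $j$ such that, for all $w \in \Sigma^*$, every occurrence of $x$ as a factor of $\varphi(w)$ begins at a position congruent to $j$ modulo $k$. -}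

module Defs where

open import Data.Nat using (ℕ; zero; suc; _+_; _*_; _∸_; _<_)
open import Data.List using (List; []; _∷_; _++_; length; take; concat; map; replicate)
open import Data.Product using (Σ; _×_; ∃)
open import Data.Sum using (_⊎_)
open import Relation.Binary.PropositionalEquality using (_≡_; _≢_)
open import Relation.Nullary using (¬_)

Word : Set
Word = List ℕ

Factor : Word → Word → Set
Factor x w = Σ Word λ u → Σ Word λ z → w ≡ u ++ x ++ z

pow : Word → ℕ → Word
pow v m = concat (replicate m v)

rep : ℕ → ℕ → List ℕ
rep m c = replicate m c

-- x is an (a/b)-power: x = v^{⌊a/b⌋} v_0 ... v_{t-1} with v nonempty,
-- b ∣ |v| (|v| = k*b), and t = |v| (a/b - ⌊a/b⌋) = k * (a mod b).
IsPower : ℕ → ℕ → Word → Set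
IsPower a b x =
  Σ Word λ v → Σ ℕ λ k → Σ ℕ λ q → Σ ℕ λ r →
    v ≢ [] × length v ≡ k * b × a ≡ q * b + r × r < b ×
    x ≡ pow v q ++ take (k * r) v

PowerFree : ℕ → ℕ → Word → Set
PowerFree a b w = ∀ x → Factor x w → ¬ IsPower a b x

Morphism : Set
Morphism = ℕ → Word

apply : Morphism → Word → Word
apply φ w = concat (map φ w)

Uniform : ℕ → Morphism → Set
Uniform k φ = ∀ n → length (φ n) ≡ k

PowerFreeMorphism : ℕ → ℕ → Morphism → Set
PowerFreeMorphism a b φ = ∀ w → PowerFree a b w → PowerFree a b (apply φ w)

ModEq : ℕ → ℕ → ℕ → Set
ModEq k i j = Σ ℕ λ q → (i ≡ j + q * k) ⊎ (j ≡ i + q * k)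

Locates : ℕ → Morphism → ℕ → Set
Locates k φ ℓ =
  ∀ (x : Word) → length x ≡ ℓ →
    Σ ℕ λ j → ∀ (w u z : Word) → apply φ w ≡ u ++ x ++ z → ModEq k (length u) j

φab : ℕ → ℕ → Morphism
φab a b n =
  rep (6 * a ∸ 7 * b ∸ 1) 0 ++ 1 ∷ rep (4 * b ∸ 3 * a ∸ 1) 0 ++ 1 ∷
  rep (10 * b ∸ 8 * a ∸ 1) 0 ++ 1 ∷ rep (6 * a ∸ 7 * b ∸ 1) 0 ++ suc n ∷ []

module Submission where

open import Defs
open import Data.Nat
open import Data.Nat.Properties
open import Data.Nat.DivMod
open import Data.Nat.Divisibility using (_∣_; divides; _∣0; ∣m+n∣m⇒∣n; n∣m*n)
open import Data.Nat.Coprimality using (Coprime; coprime-divisor)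
open import Data.Nat.Tactic.RingSolver using (solve-∀)
open import Algebra.Properties.CommutativeSemigroup +-commutativeSemigroup using () renaming (xy∙z≈xz∙y to x+y+z≡x+z+y)
open import Algebra.Properties.CommutativeSemigroup *-commutativeSemigroup using () renaming (xy∙z≈xz∙y to x*y*z≡x*z*y)
open import Data.Bool using (Bool; true; false)
import Data.Bool.Properties as Bool
open import Data.Fin using (Fin; toℕ; fromℕ<)
open import Data.Fin.Properties using (any?; all?; toℕ-fromℕ<; toℕ<n)
open import Data.List using (List; []; _∷_; _++_; length; take; drop; replicate)
open import Data.List.Properties using (length-++; length-take; length-drop; take++drop≡id; ++-identityʳ; length-replicate)
open import Data.Product using (Σ; _×_; _,_; proj₁; proj₂)
open import Data.Sum using (_⊎_; inj₁; inj₂)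
open import Data.Empty using (⊥; ⊥-elim)
open import Relation.Nullary using (¬_; Dec; yes; no; does)
open import Relation.Nullary.Decidable using (dec-true; dec-false)
open import Relation.Binary using (tri<; tri≈; tri>)
open import Relation.Binary.PropositionalEquality

-- Theorem 4.8.  Write c = 5a − 6b and d = 5b − 4a (both positive), so that
-- a = 5c + 6d, b = 4c + 5d, and φ = φab is 0^x 1 0^y 1 0^z 1 0^x (n+1) with
-- zero-runs x = 2c + d − 1, y = c + 2d − 1, z = 2d − 1.
--
-- The nonzero letters of every image φ(w) follow one a-periodic "marker
-- pattern" whose cyclic gaps are y+1, z+1, x+1, x+1.  Since x, y, z are
-- distinct (c ≠ d, d ≠ 2c, c > 0), two consecutive gaps determine the
-- phase of a mark (`phase-transfer`), so a window of length a fixes the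
-- position modulo a (`rigid`); this gives the locating property.
--
-- For power-freeness, set r = a − b = c + d.  An (a/b)-power in φ(w) is a
-- factor of period Kb and length Ka (`power⇒repetition`); on the pattern it
-- yields a window of length 2Kr with period Kr.  As no gap equals r and all
-- gaps are below 2r, such a window forces a ∣ Kr (`periodic-window`), hence
-- a ∣ K by coprimality.  The last letter n + 1 of φ(n) then lets one read
-- off a repetition of period (K/a)·b in w itself (`desubstitute`), i.e. an
-- (a/b)-power in w (`repetition⇒power`).

-- The letter of a word at a position (0 outside the word).  Equalities of
-- words are reduced to equalities of letters through `at-ext`.
at : Word → ℕ → ℕ
at []      _       = 0
at (c ∷ l) zero    = c
at (c ∷ l) (suc n) = at l n

at-++ˡ : ∀ l₁ l₂ n → n < length l₁ → at (l₁ ++ l₂) n ≡ at l₁ n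
at-++ˡ (c ∷ l₁) l₂ zero    _         = refl
at-++ˡ (c ∷ l₁) l₂ (suc n) (s≤s n<l) = at-++ˡ l₁ l₂ n n<l

at-++ʳ : ∀ l₁ l₂ n → at (l₁ ++ l₂) (length l₁ + n) ≡ at l₂ n
at-++ʳ []       l₂ n = refl
at-++ʳ (c ∷ l₁) l₂ n = at-++ʳ l₁ l₂ n

at-take : ∀ m l n → n < m → at (take m l) n ≡ at l n
at-take (suc m) []      n       _         = refl
at-take (suc m) (c ∷ l) zero    _         = refl
at-take (suc m) (c ∷ l) (suc n) (s≤s n<m) = at-take m l n n<m

at-drop : ∀ m l n → at (drop m l) n ≡ at l (m + n)
at-drop zero    l       n = refl
at-drop (suc m) []      n = refl
at-drop (suc m) (c ∷ l) n = at-drop m l n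

at-replicate : ∀ m c l n → n < m → at (replicate m c ++ l) n ≡ c
at-replicate (suc m) c l zero    _         = refl
at-replicate (suc m) c l (suc n) (s≤s n<m) = at-replicate m c l n n<m

at-after-replicate : ∀ m c l n → at (replicate m c ++ l) (m + n) ≡ at l n
at-after-replicate zero    c l n = refl
at-after-replicate (suc m) c l n = at-after-replicate m c l n

at-ext : ∀ l₁ l₂ → length l₁ ≡ length l₂ → (∀ n → n < length l₁ → at l₁ n ≡ at l₂ n) → l₁ ≡ l₂
at-ext []       []       _ _ = refl
at-ext (c ∷ l₁) (d ∷ l₂) e h =
  cong₂ _∷_ (h 0 z<s) (at-ext l₁ l₂ (suc-injective e) (λ n n<l → h (suc n) (s<s n<l)))

at-occurrence : ∀ {W : Word} (u x z : Word) → W ≡ u ++ x ++ z → ∀ j → j < length x → at W (length u + j) ≡ at x j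
at-occurrence u x z refl j j<x = trans (at-++ʳ u (x ++ z) j) (at-++ˡ x z j j<x)

occurrence-end : ∀ {W : Word} (u x z : Word) → W ≡ u ++ x ++ z → length u + length x ≤ length W
occurrence-end u x z refl rewrite length-++ u {x ++ z} | length-++ x {z} =
  +-monoʳ-≤ (length u) (m≤m+n (length x) (length z))

length-apply : ∀ {a} (φ : Morphism) → Uniform a φ → ∀ w → length (apply φ w) ≡ length w * a
length-apply φ U []      = refl
length-apply φ U (c ∷ w) = trans (length-++ (φ c)) (cong₂ _+_ (U c) (length-apply φ U w))

at-apply : ∀ {a} (φ : Morphism) → Uniform a φ → ∀ w q ρ → q < length w → ρ < a →
           at (apply φ w) (q * a + ρ) ≡ at (φ (at w q)) ρ
at-apply     φ U (c ∷ w) zero    ρ _         ρ<a = at-++ˡ (φ c) (apply φ w) ρ (subst (ρ <_) (sym (U c)) ρ<a)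
at-apply {a} φ U (c ∷ w) (suc q) ρ (s≤s q<w) ρ<a = begin
  at (φ c ++ apply φ w) (a + q * a + ρ)              ≡⟨ cong (at (φ c ++ apply φ w)) (trans (+-assoc a (q * a) ρ) (cong (_+ (q * a + ρ)) (sym (U c)))) ⟩
  at (φ c ++ apply φ w) (length (φ c) + (q * a + ρ)) ≡⟨ at-++ʳ (φ c) (apply φ w) (q * a + ρ) ⟩
  at (apply φ w) (q * a + ρ)                         ≡⟨ at-apply φ U w q ρ q<w ρ<a ⟩
  at (φ (at w q)) ρ                                  ∎
  where open ≡-Reasoning

module _ (a : ℕ) .{{_ : NonZero a}} where

  %-shift : ∀ n m t → n % a ≡ m % a → (n + t) % a ≡ (m + t) % a
  %-shift n m t e = begin
    (n + t) % a             ≡⟨ %-distribˡ-+ n t a ⟩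
    (n % a + t % a) % a     ≡⟨ cong (λ u → (u + t % a) % a) e ⟩
    (m % a + t % a) % a     ≡⟨ %-distribˡ-+ m t a ⟨
    (m + t) % a             ∎
    where open ≡-Reasoning

  %-offset : ∀ n m → n % a ≡ m % a → m / a ≤ n / a → n ≡ m + (n / a ∸ m / a) * a
  %-offset n m e le = begin
    n                                          ≡⟨ m≡m%n+[m/n]*n n a ⟩
    n % a + n / a * a                          ≡⟨ cong₂ (λ u v → u + v * a) e (sym (m+[n∸m]≡n le)) ⟩
    m % a + (m / a + (n / a ∸ m / a)) * a      ≡⟨ cong (m % a +_) (*-distribʳ-+ a (m / a) _) ⟩
    m % a + (m / a * a + (n / a ∸ m / a) * a)  ≡⟨ +-assoc (m % a) _ _ ⟨
    m % a + m / a * a + (n / a ∸ m / a) * a    ≡⟨ cong (_+ (n / a ∸ m / a) * a) (m≡m%n+[m/n]*n m a) ⟨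
    m + (n / a ∸ m / a) * a                    ∎
    where open ≡-Reasoning

  %-modEq : ∀ n m → n % a ≡ m % a → ModEq a n m
  %-modEq n m e with ≤-total (n / a) (m / a)
  ... | inj₁ le = m / a ∸ n / a , inj₂ (%-offset m n (sym e) le)
  ... | inj₂ le = n / a ∸ m / a , inj₁ (%-offset n m e le)

  modEq-cancelʳ : ∀ n m e → ModEq a (n + e) (m + e) → ModEq a n m
  modEq-cancelʳ n m e (q , inj₁ h) = q , inj₁ (+-cancelʳ-≡ e n (m + q * a) (trans h (x+y+z≡x+z+y m e (q * a))))
  modEq-cancelʳ n m e (q , inj₂ h) = q , inj₂ (+-cancelʳ-≡ e m (n + q * a) (trans h (x+y+z≡x+z+y n e (q * a))))

  %-stable⇒∣ : ∀ p L → (p + L) % a ≡ p % a → a ∣ L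
  %-stable⇒∣ p L e with %-modEq (p + L) p e
  ... | q , inj₁ h = divides q (+-cancelˡ-≡ p L (q * a) h)
  ... | q , inj₂ h = subst (a ∣_) (sym L≡0) (a ∣0)
    where
    L≡0 : L ≡ 0
    L≡0 = m+n≡0⇒m≡0 L (sym (+-cancelˡ-≡ p 0 (L + q * a) (trans (+-identityʳ p) (trans h (+-assoc p L _)))))

Repetition : Word → ℕ → ℕ → ℕ → Set
Repetition w o p n = o + p + n ≤ length w × (∀ j → j < n → at w (o + j) ≡ at w (o + p + j))

power-exponent : ∀ {a b r} q r′ → a ≡ b + r → r < b → a ≡ q * b + r′ → r′ < b → q ≡ 1 × r′ ≡ r
power-exponent {b = b} {r} zero r′ a≡ r<b a≡′ r′<b =
  ⊥-elim (<⇒≱ r′<b (subst (b ≤_) (trans (sym a≡) a≡′) (m≤m+n b r)))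
power-exponent {b = b} {r} (suc zero) r′ a≡ r<b a≡′ r′<b =
  refl , +-cancelˡ-≡ b r′ r (trans (cong (_+ r′) (sym (+-identityʳ b))) (trans (sym a≡′) a≡))
power-exponent {b = b} {r} (suc (suc q)) r′ a≡ r<b a≡′ r′<b =
  ⊥-elim (<⇒≱ (+-monoʳ-< b r<b) (subst (b + b ≤_) (trans (sym a≡′) a≡)
    (≤-trans (+-monoʳ-≤ b (m≤m+n b (q * b))) (m≤m+n _ r′))))

at-pow₁ˡ : ∀ v l i → i < length v → at (pow v 1 ++ l) i ≡ at v i
at-pow₁ˡ v l i i<v = trans (at-++ˡ (v ++ []) l i (subst (i <_) (cong length (sym (++-identityʳ v))) i<v))
                           (cong (λ u → at u i) (++-identityʳ v))

at-pow₁ʳ : ∀ v l j → at (pow v 1 ++ l) (length v + j) ≡ at l j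
at-pow₁ʳ v l j = trans (cong (λ m → at (pow v 1 ++ l) (m + j)) (cong length (sym (++-identityʳ v))))
                       (at-++ʳ (v ++ []) l j)

prefix-power-periodic : ∀ v n → n ≤ length v →
  length (pow v 1 ++ take n v) ≡ length v + n ×
  (∀ j → j < n → at (pow v 1 ++ take n v) j ≡ at (pow v 1 ++ take n v) (length v + j))
prefix-power-periodic v n n≤v = len , periodic
  where
  len : length (pow v 1 ++ take n v) ≡ length v + n
  len = begin
    length (pow v 1 ++ take n v)         ≡⟨ length-++ (v ++ []) ⟩
    length (v ++ []) + length (take n v) ≡⟨ cong₂ _+_ (cong length (++-identityʳ v)) (length-take n v) ⟩
    length v + n ⊓ length v              ≡⟨ cong (length v +_) (m≤n⇒m⊓n≡m n≤v) ⟩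
    length v + n                         ∎
    where open ≡-Reasoning
  periodic : ∀ j → j < n → at (pow v 1 ++ take n v) j ≡ at (pow v 1 ++ take n v) (length v + j)
  periodic j j<n = begin
    at (pow v 1 ++ take n v) j                ≡⟨ at-pow₁ˡ v (take n v) j (<-≤-trans j<n n≤v) ⟩
    at v j                                    ≡⟨ at-take n v j j<n ⟨
    at (take n v) j                           ≡⟨ at-pow₁ʳ v (take n v) j ⟨
    at (pow v 1 ++ take n v) (length v + j)   ∎
    where open ≡-Reasoning

periodic⇒prefix-power : ∀ x p n → length x ≡ p + n → n ≤ p →
  (∀ j → j < n → at x j ≡ at x (p + j)) → x ≡ pow (take p x) 1 ++ take n (take p x)
periodic⇒prefix-power x p n x≡ n≤p per =
  at-ext x y (trans x≡ (sym (trans y≡ (cong (_+ n) v≡)))) same-letters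
  where
  v = take p x
  y = pow v 1 ++ take n v
  v≡ : length v ≡ p
  v≡ = trans (length-take p x) (m≤n⇒m⊓n≡m (subst (p ≤_) (sym x≡) (m≤m+n p n)))
  n≤v : n ≤ length v
  n≤v = subst (n ≤_) (sym v≡) n≤p
  y≡ : length y ≡ length v + n
  y≡ = proj₁ (prefix-power-periodic v n n≤v)
  on-prefix : ∀ i → i < p → at x i ≡ at y i
  on-prefix i i<p = sym (trans (at-pow₁ˡ v (take n v) i (subst (i <_) (sym v≡) i<p)) (at-take p x i i<p))
  same-letters : ∀ i → i < length x → at x i ≡ at y i
  same-letters i i<x with i <? p
  ... | yes i<p = on-prefix i i<p
  ... | no i≮p = begin
    at x i              ≡⟨ cong (at x) i≡ ⟨
    at x (p + j)        ≡⟨ per j j<n ⟨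
    at x j              ≡⟨ on-prefix j (<-≤-trans j<n n≤p) ⟩
    at y j              ≡⟨ proj₂ (prefix-power-periodic v n n≤v) j j<n ⟩
    at y (length v + j) ≡⟨ cong (λ m → at y (m + j)) v≡ ⟩
    at y (p + j)        ≡⟨ cong (at y) i≡ ⟩
    at y i              ∎
    where
    open ≡-Reasoning
    j = i ∸ p
    i≡ : p + j ≡ i
    i≡ = m+[n∸m]≡n (≮⇒≥ i≮p)
    j<n : j < n
    j<n = +-cancelˡ-< p j n (subst (_< p + n) (sym i≡) (subst (i <_) x≡ i<x))

occurrence-repetition : ∀ {W : Word} (u x z : Word) p n → W ≡ u ++ x ++ z → length x ≡ p + n →
  (∀ j → j < n → at x j ≡ at x (p + j)) → Repetition W (length u) p n
occurrence-repetition {W} u x z p n W≡ x≡ per = bound , periodic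
  where
  bound : length u + p + n ≤ length W
  bound = subst (_≤ length W) (trans (cong (length u +_) x≡) (sym (+-assoc (length u) p n))) (occurrence-end u x z W≡)
  periodic : ∀ j → j < n → at W (length u + j) ≡ at W (length u + p + j)
  periodic j j<n = begin
    at W (length u + j)       ≡⟨ at-occurrence u x z W≡ j (subst (j <_) (sym x≡) (<-≤-trans j<n (m≤n+m n p))) ⟩
    at x j                    ≡⟨ per j j<n ⟩
    at x (p + j)              ≡⟨ at-occurrence u x z W≡ (p + j) (subst (p + j <_) (sym x≡) (+-monoʳ-< p j<n)) ⟨
    at W (length u + (p + j)) ≡⟨ cong (at W) (+-assoc (length u) p j) ⟨
    at W (length u + p + j)   ∎
    where open ≡-Reasoning

nonempty-multiple : ∀ (v : Word) k b → v ≢ [] → length v ≡ k * b → Σ ℕ λ k′ → k ≡ suc k′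
nonempty-multiple []      _       _ v≢[] _  = ⊥-elim (v≢[] refl)
nonempty-multiple (_ ∷ _) (suc k) _ _    _  = k , refl

power⇒repetition : ∀ {a b r} → a ≡ b + r → r < b → ∀ W x → Factor x W → IsPower a b x →
  Σ ℕ λ k → Σ ℕ λ o → Repetition W o (suc k * b) (suc k * r)
power⇒repetition {b = b} {r} a≡ r<b W x (u , z , W≡) (v , k , q , r′ , v≢[] , v≡ , a≡′ , r′<b , refl)
  with power-exponent q r′ a≡ r<b a≡′ r′<b | nonempty-multiple v k b v≢[] v≡
... | refl , refl | k′ , refl = k′ , length u ,
  subst (λ p → Repetition W (length u) p (k * r)) v≡
    (occurrence-repetition u x z (length v) (k * r) W≡ (proj₁ periodic) (proj₂ periodic))
  where
  kr≤v : k * r ≤ length v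
  kr≤v = subst (k * r ≤_) (sym v≡) (*-monoʳ-≤ k (<⇒≤ r<b))
  periodic = prefix-power-periodic v (k * r) kr≤v

repetition⇒power : ∀ {a b r} → a ≡ b + r → r < b → ∀ w o k →
  Repetition w o (suc k * b) (suc k * r) → ¬ PowerFree a b w
repetition⇒power {a} {b} {r} a≡ r<b w o k (bound , per) free =
  free x (take o w , drop (p + n) (drop o w) , w≡) (v , suc k , 1 , r , v≢[] , v≡ , a≡1·b+r , r<b , x≡)
  where
  p = suc k * b
  n = suc k * r
  x = take (p + n) (drop o w)
  v = take p x
  w≡ : w ≡ take o w ++ x ++ drop (p + n) (drop o w)
  w≡ = sym (trans (cong (take o w ++_) (take++drop≡id (p + n) (drop o w))) (take++drop≡id o w))
  x≡ₗ : length x ≡ p + n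
  x≡ₗ = trans (length-take (p + n) (drop o w)) (m≤n⇒m⊓n≡m (subst (p + n ≤_) (sym (length-drop o w))
          (subst (_≤ length w ∸ o) (m+n∸m≡n o (p + n)) (∸-monoˡ-≤ o (subst (_≤ length w) (+-assoc o p n) bound)))))
  at-x : ∀ j → j < p + n → at x j ≡ at w (o + j)
  at-x j j<p+n = trans (at-take (p + n) (drop o w) j j<p+n) (at-drop o w j)
  n≤p : n ≤ p
  n≤p = *-monoʳ-≤ (suc k) (<⇒≤ r<b)
  per-x : ∀ j → j < n → at x j ≡ at x (p + j)
  per-x j j<n = begin
    at x j           ≡⟨ at-x j (<-≤-trans j<n (m≤n+m n p)) ⟩
    at w (o + j)     ≡⟨ per j j<n ⟩
    at w (o + p + j) ≡⟨ cong (at w) (+-assoc o p j) ⟩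
    at w (o + (p + j)) ≡⟨ at-x (p + j) (+-monoʳ-< p j<n) ⟨
    at x (p + j)     ∎
    where open ≡-Reasoning
  x≡ : x ≡ pow v 1 ++ take n v
  x≡ = periodic⇒prefix-power x p n x≡ₗ n≤p per-x
  v≡ : length v ≡ suc k * b
  v≡ = trans (length-take p x) (m≤n⇒m⊓n≡m (subst (p ≤_) (sym x≡ₗ) (m≤m+n p n)))
  v≢[] : v ≢ []
  v≢[] v≡[] = <⇒≢ (≤-<-trans z≤n r<b) (sym (m+n≡0⇒m≡0 b (trans (sym v≡) (cong length v≡[]))))
  a≡1·b+r : a ≡ 1 * b + r
  a≡1·b+r = trans a≡ (cong (_+ r) (sym (*-identityˡ b)))

-- A
-- repetition in φ(w) of period p(m+1) and excess n(m+1) comes from a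
-- repetition in w of period p and excess n: the last letters of the blocks
-- it covers spell out the corresponding factor of w.
desubstitute : ∀ m (φ : Morphism) → Uniform (suc m) φ →
  (∀ c c′ → at (φ c) m ≡ at (φ c′) m → c ≡ c′) →
  ∀ w o p n → Repetition (apply φ w) o (p * suc m) (n * suc m) → Repetition w (o / suc m) p n
desubstitute m φ U last-injective w o p n (bound , per) = bound′ , per′
  where
  a = suc m
  W = apply φ w
  Q = o / a
  ρ = o % a
  D = m ∸ ρ
  o≡ : o ≡ Q * a + ρ
  o≡ = trans (m≡m%n+[m/n]*n o a) (+-comm ρ (Q * a))
  ρ+D≡m : ρ + D ≡ m
  ρ+D≡m = m+[n∸m]≡n (<⇒≤pred (m%n<n o a))
  regroup : ∀ Q ρ i a D → Q * a + ρ + (i * a + D) ≡ (Q + i) * a + (ρ + D)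
  regroup = solve-∀
  regroup′ : ∀ Q ρ p i a D → Q * a + ρ + p * a + (i * a + D) ≡ (Q + p + i) * a + (ρ + D)
  regroup′ = solve-∀
  -- Inside the repetition, the blocks of φ(w) end at offsets i·a + D.
  block-end : ∀ i → o + (i * a + D) ≡ (Q + i) * a + m
  block-end i = trans (cong (_+ (i * a + D)) o≡) (trans (regroup Q ρ i a D) (cong ((Q + i) * a +_) ρ+D≡m))
  block-end′ : ∀ i → o + p * a + (i * a + D) ≡ (Q + p + i) * a + m
  block-end′ i = trans (cong (λ o → o + p * a + (i * a + D)) o≡)
                   (trans (regroup′ Q ρ p i a D) (cong ((Q + p + i) * a +_) ρ+D≡m))
  inside : ∀ i → i < n → i * a + D < n * a
  inside i i<n = begin-strict
    i * a + D  ≤⟨ +-monoʳ-≤ (i * a) (m∸n≤m m ρ) ⟩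
    i * a + m  <⟨ +-monoʳ-< (i * a) (n<1+n m) ⟩
    i * a + a  ≡⟨ +-comm (i * a) a ⟩
    suc i * a  ≤⟨ *-monoˡ-≤ a i<n ⟩
    n * a      ∎
    where open ≤-Reasoning
  expand : ∀ Q p n a → (Q + p + n) * a ≡ Q * a + p * a + n * a
  expand = solve-∀
  bound′ : Q + p + n ≤ length w
  bound′ = *-cancelʳ-≤ (Q + p + n) (length w) a (begin
    (Q + p + n) * a         ≡⟨ expand Q p n a ⟩
    Q * a + p * a + n * a   ≤⟨ +-monoˡ-≤ (n * a) (+-monoˡ-≤ (p * a) (m/n*n≤m o a)) ⟩
    o + p * a + n * a       ≤⟨ bound ⟩
    length W                ≡⟨ length-apply φ U w ⟩
    length w * a            ∎)
    where open ≤-Reasoning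
  last-letter : ∀ q → q < length w → at W (q * a + m) ≡ at (φ (at w q)) m
  last-letter q q<w = at-apply φ U w q m q<w (n<1+n m)
  per′ : ∀ i → i < n → at w (Q + i) ≡ at w (Q + p + i)
  per′ i i<n = last-injective _ _ (begin
    at (φ (at w (Q + i))) m         ≡⟨ last-letter (Q + i) (<-≤-trans (+-monoʳ-< Q (<-≤-trans i<n (m≤n+m n p))) (subst (_≤ length w) (+-assoc Q p n) bound′)) ⟨
    at W ((Q + i) * a + m)          ≡⟨ cong (at W) (block-end i) ⟨
    at W (o + (i * a + D))          ≡⟨ per (i * a + D) (inside i i<n) ⟩
    at W (o + p * a + (i * a + D))  ≡⟨ cong (at W) (block-end′ i) ⟩
    at W ((Q + p + i) * a + m)      ≡⟨ last-letter (Q + p + i) (<-≤-trans (+-monoʳ-< (Q + p) i<n) bound′) ⟩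
    at (φ (at w (Q + p + i))) m     ∎)
    where open ≡-Reasoning

true≢false : true ≢ false
true≢false ()

rotate : ∀ p q r s → p + q + r + s ≡ q + r + s + p
rotate = solve-∀

-- The marker pattern of period a = 2x + y + z + 4: the residues
-- R₀ = x, R₁ = R₀ + (y+1), R₂ = R₁ + (z+1), R₃ = R₂ + (x+1) = a − 1 are
-- marked, so that the cyclic gaps between consecutive marks are
-- y+1, z+1, x+1, x+1.  When these three gap lengths are distinct, two
-- consecutive gaps determine the phase; this rigidity drives both the
-- locating property and the exclusion of short periods.
module Markers (x y z : ℕ) (x≢y : x ≢ y) (x≢z : x ≢ z) (y≢z : y ≢ z) where

  data Phase : Set where
    p₀ p₁ p₂ p₃ : Phase

  next : Phase → Phase
  next p₀ = p₁
  next p₁ = p₂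
  next p₂ = p₃
  next p₃ = p₀

  previous : ∀ τ → Σ Phase λ σ → next σ ≡ τ
  previous p₀ = p₃ , refl
  previous p₁ = p₀ , refl
  previous p₂ = p₁ , refl
  previous p₃ = p₂ , refl

  G : Phase → ℕ
  G σ = suc (zeros σ)
    where
    zeros : Phase → ℕ
    zeros p₀ = y
    zeros p₁ = z
    zeros p₂ = x
    zeros p₃ = x

  R₀ R₁ R₂ R₃ : ℕ
  R₀ = x
  R₁ = R₀ + G p₀
  R₂ = R₁ + G p₁
  R₃ = R₂ + G p₂

  R : Phase → ℕ
  R p₀ = R₀
  R p₁ = R₁
  R p₂ = R₂
  R p₃ = R₃

  a : ℕ
  a = suc R₃

  R₀<R₁ : R₀ < R₁
  R₀<R₁ = m<m+n x z<s
  R₁<R₂ : R₁ < R₂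
  R₁<R₂ = m<m+n R₁ z<s
  R₂<R₃ : R₂ < R₃
  R₂<R₃ = m<m+n R₂ z<s

  R₁<R₃ : R₁ < R₃
  R₁<R₃ = <-trans R₁<R₂ R₂<R₃
  R₀<R₂ : R₀ < R₂
  R₀<R₂ = <-trans R₀<R₁ R₁<R₂
  R₀<R₃ : R₀ < R₃
  R₀<R₃ = <-trans R₀<R₁ R₁<R₃

  R<a : ∀ σ → R σ < a
  R<a p₀ = <-trans R₀<R₃ (n<1+n _)
  R<a p₁ = <-trans R₁<R₃ (n<1+n _)
  R<a p₂ = <-trans R₂<R₃ (n<1+n _)
  R<a p₃ = n<1+n _

  wrap : ∀ t → t < a → (R₃ + suc t) % a ≡ t
  wrap t t<a = trans (cong (_% a) (trans (+-suc R₃ t) (+-comm a t))) (trans ([m+n]%n≡m%n t a) (m<n⇒m%n≡m t<a))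

  R-step : ∀ σ → (R σ + G σ) % a ≡ R (next σ)
  R-step p₀ = m<n⇒m%n≡m (R<a p₁)
  R-step p₁ = m<n⇒m%n≡m (R<a p₂)
  R-step p₂ = m<n⇒m%n≡m (R<a p₃)
  R-step p₃ = wrap x (R<a p₀)

  R%a : ∀ σ → R σ % a ≡ R σ
  R%a σ = m<n⇒m%n≡m (R<a σ)

  Marked : ℕ → Set
  Marked ρ = Σ Phase λ σ → ρ ≡ R σ

  marked? : ∀ ρ → Dec (Marked ρ)
  marked? ρ with ρ ≟ R₀ | ρ ≟ R₁ | ρ ≟ R₂ | ρ ≟ R₃
  ... | yes e | _     | _     | _     = yes (p₀ , e)
  ... | no _  | yes e | _     | _     = yes (p₁ , e)
  ... | no _  | no _  | yes e | _     = yes (p₂ , e)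
  ... | no _  | no _  | no _  | yes e = yes (p₃ , e)
  ... | no n₀ | no n₁ | no n₂ | no n₃ = no λ { (p₀ , e) → n₀ e ; (p₁ , e) → n₁ e ; (p₂ , e) → n₂ e ; (p₃ , e) → n₃ e }

  mark : ℕ → Bool
  mark n = does (marked? (n % a))

  _⟨_⟩ : ℕ → Phase → Set
  n ⟨ σ ⟩ = n % a ≡ R σ

  mark-cong : ∀ n m → n % a ≡ m % a → mark n ≡ mark m
  mark-cong _ _ = cong (λ ρ → does (marked? ρ))

  mark-of-phase : ∀ n σ → n ⟨ σ ⟩ → mark n ≡ true
  mark-of-phase n σ e = dec-true (marked? (n % a)) (σ , e)

  phase-of-mark : ∀ n → mark n ≡ true → Σ Phase λ σ → n ⟨ σ ⟩
  phase-of-mark n h with marked? (n % a) | h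
  ... | yes m | _ = m

  next-mark : ∀ n σ → n ⟨ σ ⟩ → (n + G σ) ⟨ next σ ⟩
  next-mark n σ e = trans (%-shift a n (R σ) (G σ) (trans e (sym (R%a σ)))) (R-step σ)

  mark-periodic : ∀ n k → mark (n + k * a) ≡ mark n
  mark-periodic n k = mark-cong (n + k * a) n ([m+kn]%n≡m%n n k a)

  below₀ : ∀ ρ → ρ < R₀ → ¬ Marked ρ
  below₀ ρ h = λ { (p₀ , e) → <⇒≢ h e ; (p₁ , e) → <⇒≢ (<-trans h R₀<R₁) e
                 ; (p₂ , e) → <⇒≢ (<-trans h R₀<R₂) e ; (p₃ , e) → <⇒≢ (<-trans h R₀<R₃) e }
  between₀₁ : ∀ ρ → R₀ < ρ → ρ < R₁ → ¬ Marked ρ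
  between₀₁ ρ l h = λ { (p₀ , e) → >⇒≢ l e ; (p₁ , e) → <⇒≢ h e
                      ; (p₂ , e) → <⇒≢ (<-trans h R₁<R₂) e ; (p₃ , e) → <⇒≢ (<-trans h R₁<R₃) e }
  between₁₂ : ∀ ρ → R₁ < ρ → ρ < R₂ → ¬ Marked ρ
  between₁₂ ρ l h = λ { (p₀ , e) → >⇒≢ (<-trans R₀<R₁ l) e ; (p₁ , e) → >⇒≢ l e
                      ; (p₂ , e) → <⇒≢ h e ; (p₃ , e) → <⇒≢ (<-trans h R₂<R₃) e }
  between₂₃ : ∀ ρ → R₂ < ρ → ρ < R₃ → ¬ Marked ρ
  between₂₃ ρ l h = λ { (p₀ , e) → >⇒≢ (<-trans R₀<R₂ l) e ; (p₁ , e) → >⇒≢ (<-trans R₁<R₂ l) e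
                      ; (p₂ , e) → >⇒≢ l e ; (p₃ , e) → <⇒≢ h e }

  in-gap-unmarked : ∀ σ t → 0 < t → t < G σ → ¬ Marked ((R σ + t) % a)
  in-gap-unmarked p₀ t 0<t t<G = subst (λ ρ → ¬ Marked ρ) (sym (m<n⇒m%n≡m (<-trans h (R<a p₁))))
                                   (between₀₁ _ (m<m+n R₀ 0<t) h)
    where h = +-monoʳ-< R₀ t<G
  in-gap-unmarked p₁ t 0<t t<G = subst (λ ρ → ¬ Marked ρ) (sym (m<n⇒m%n≡m (<-trans h (R<a p₂))))
                                   (between₁₂ _ (m<m+n R₁ 0<t) h)
    where h = +-monoʳ-< R₁ t<G
  in-gap-unmarked p₂ t 0<t t<G = subst (λ ρ → ¬ Marked ρ) (sym (m<n⇒m%n≡m (<-trans h (R<a p₃))))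
                                   (between₂₃ _ (m<m+n R₂ 0<t) h)
    where h = +-monoʳ-< R₂ t<G
  in-gap-unmarked p₃ (suc t) _ (s≤s t<x) = subst (λ ρ → ¬ Marked ρ) (sym (wrap t (<-trans t<x (R<a p₀))))
                                             (below₀ t t<x)

  InGap : ℕ → Set
  InGap ρ = Σ Phase λ σ → Σ ℕ λ t → 0 < t × t < G σ × (R σ + t) % a ≡ ρ

  gap-at : ∀ {ρ} → ρ < a → ∀ σ → R σ < ρ → ρ < R σ + G σ → InGap ρ
  gap-at {ρ} ρ<a σ l h = σ , ρ ∸ R σ , m<n⇒0<n∸m l ,
                         +-cancelˡ-< (R σ) _ _ (subst (_< R σ + G σ) (sym split) h) ,
                         trans (cong (_% a) split) (m<n⇒m%n≡m ρ<a)
    where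
    split : R σ + (ρ ∸ R σ) ≡ ρ
    split = m+[n∸m]≡n (<⇒≤ l)

  classify : ∀ ρ → ρ < a → Marked ρ ⊎ InGap ρ
  classify ρ ρ<a with <-cmp ρ R₀
  ... | tri< lt _ _ = inj₂ (p₃ , suc ρ , z<s , s<s lt , wrap ρ ρ<a)
  ... | tri≈ _ e _  = inj₁ (p₀ , e)
  ... | tri> _ _ gt₀ with <-cmp ρ R₁
  ... | tri< lt _ _ = inj₂ (gap-at ρ<a p₀ gt₀ lt)
  ... | tri≈ _ e _  = inj₁ (p₁ , e)
  ... | tri> _ _ gt₁ with <-cmp ρ R₂
  ... | tri< lt _ _ = inj₂ (gap-at ρ<a p₁ gt₁ lt)
  ... | tri≈ _ e _  = inj₁ (p₂ , e)
  ... | tri> _ _ gt₂ with <-cmp ρ R₃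
  ... | tri< lt _ _ = inj₂ (gap-at ρ<a p₂ gt₂ lt)
  ... | tri≈ _ e _  = inj₁ (p₃ , e)
  ... | tri> _ _ gt₃ = ⊥-elim (≤⇒≯ (<⇒≤pred ρ<a) gt₃)

  unmarked-after : ∀ n σ t → n ⟨ σ ⟩ → 0 < t → t < G σ → mark (n + t) ≡ false
  unmarked-after n σ t e 0<t t<G =
    trans (mark-cong (n + t) (R σ + t) (%-shift a n (R σ) t (trans e (sym (R%a σ)))))
          (dec-false (marked? _) (in-gap-unmarked σ t 0<t t<G))

  first-mark : ∀ s → Σ Phase λ σ → Σ ℕ λ e →
    e < G σ × (s + e) ⟨ next σ ⟩ × (∀ t → t < e → mark (s + t) ≡ false)
  first-mark s with classify (s % a) (m%n<n s a)
  ... | inj₁ (τ , e) with previous τ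
  ... | σ , refl = σ , 0 , z<s , trans (cong (_% a) (+-identityʳ s)) e , λ _ ()
  first-mark s | inj₂ (σ , t , 0<t , t<G , e) = σ , G σ ∸ t , ∸-monoʳ-< 0<t (<⇒≤ t<G) , reaches , before
    where
    reaches : (s + (G σ ∸ t)) ⟨ next σ ⟩
    reaches = trans (%-shift a s (R σ + t) (G σ ∸ t) (sym e))
                (trans (cong (_% a) (trans (+-assoc (R σ) t _) (cong (R σ +_) (m+[n∸m]≡n (<⇒≤ t<G))))) (R-step σ))
    before : ∀ t′ → t′ < G σ ∸ t → mark (s + t′) ≡ false
    before t′ t′< = trans (mark-cong (s + t′) (R σ + (t + t′)) (trans (%-shift a s (R σ + t) t′ (sym e)) (cong (_% a) (+-assoc (R σ) t t′))))
                      (unmarked-after (R σ) σ (t + t′) (R%a σ) (<-≤-trans 0<t (m≤m+n t t′))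
                        (subst (t + t′ <_) (m+[n∸m]≡n (<⇒≤ t<G)) (+-monoʳ-< t t′<)))

  NextMark : ℕ → ℕ → Set
  NextMark n d = 0 < d × mark (n + d) ≡ true × (∀ t → 0 < t → t < d → mark (n + t) ≡ false)

  next-of-phase : ∀ n σ → n ⟨ σ ⟩ → NextMark n (G σ)
  next-of-phase n σ e = z<s , mark-of-phase (n + G σ) (next σ) (next-mark n σ e) , λ t → unmarked-after n σ t e

  gap-determined : ∀ n σ d → n ⟨ σ ⟩ → NextMark n d → d ≡ G σ
  gap-determined n σ d e (0<d , marked , before) with <-cmp d (G σ)
  ... | tri< d<G _ _ = ⊥-elim (true≢false (trans (sym marked) (unmarked-after n σ d e 0<d d<G)))
  ... | tri≈ _ d≡G _ = d≡G
  ... | tri> _ _ G<d = ⊥-elim (true≢false (trans (sym (mark-of-phase (n + G σ) (next σ) (next-mark n σ e))) (before (G σ) z<s G<d)))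

  Agree : ℕ → ℕ → ℕ → Set
  Agree p q d = ∀ t → t ≤ d → mark (p + t) ≡ mark (q + t)

  agree-restrict : ∀ p q {d d′} → d′ ≤ d → Agree p q d → Agree p q d′
  agree-restrict p q d′≤d agree t t≤ = agree t (≤-trans t≤ d′≤d)

  agree-shift : ∀ p q d d′ → Agree p q (d + d′) → Agree (p + d) (q + d) d′
  agree-shift p q d d′ agree t t≤ =
    trans (cong mark (+-assoc p d t)) (trans (agree (d + t) (+-monoʳ-≤ d t≤)) (cong mark (sym (+-assoc q d t))))

  next-mark-transfer : ∀ p q d → Agree p q d → NextMark p d → NextMark q d
  next-mark-transfer p q d agree (0<d , marked , before) =
    0<d , trans (sym (agree d ≤-refl)) marked , λ t 0<t t<d → trans (sym (agree t (<⇒≤ t<d))) (before t 0<t t<d)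

  -- Consecutive pairs of gaps (y+1, z+1), (z+1, x+1), (x+1, x+1), (x+1, y+1)
  -- are pairwise distinct, so they determine the phase.
  gaps-determine-phase : ∀ τ σ → G τ ≡ G σ → G (next τ) ≡ G (next σ) → τ ≡ σ
  gaps-determine-phase p₀ p₀ _ _ = refl
  gaps-determine-phase p₀ p₁ e _ = ⊥-elim (y≢z (suc-injective e))
  gaps-determine-phase p₀ p₂ e _ = ⊥-elim (x≢y (sym (suc-injective e)))
  gaps-determine-phase p₀ p₃ e _ = ⊥-elim (x≢y (sym (suc-injective e)))
  gaps-determine-phase p₁ p₀ e _ = ⊥-elim (y≢z (sym (suc-injective e)))
  gaps-determine-phase p₁ p₁ _ _ = refl
  gaps-determine-phase p₁ p₂ e _ = ⊥-elim (x≢z (sym (suc-injective e)))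
  gaps-determine-phase p₁ p₃ e _ = ⊥-elim (x≢z (sym (suc-injective e)))
  gaps-determine-phase p₂ p₀ e _ = ⊥-elim (x≢y (suc-injective e))
  gaps-determine-phase p₂ p₁ e _ = ⊥-elim (x≢z (suc-injective e))
  gaps-determine-phase p₂ p₂ _ _ = refl
  gaps-determine-phase p₂ p₃ _ e = ⊥-elim (x≢y (suc-injective e))
  gaps-determine-phase p₃ p₀ e _ = ⊥-elim (x≢y (suc-injective e))
  gaps-determine-phase p₃ p₁ e _ = ⊥-elim (x≢z (suc-injective e))
  gaps-determine-phase p₃ p₂ _ e = ⊥-elim (x≢y (sym (suc-injective e)))
  gaps-determine-phase p₃ p₃ _ _ = refl

  gap-two-ahead : ∀ σ → G σ ≢ G (next (next σ))
  gap-two-ahead p₀ e = x≢y (sym (suc-injective e))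
  gap-two-ahead p₁ e = x≢z (sym (suc-injective e))
  gap-two-ahead p₂ e = x≢y (suc-injective e)
  gap-two-ahead p₃ e = x≢z (suc-injective e)

  -- The four gaps add up to the period, so three consecutive gaps fit in it.
  gaps-total : ∀ σ → G σ + G (next σ) + G (next (next σ)) + G (next (next (next σ))) ≡ a
  gaps-total p₃ = refl
  gaps-total p₂ = rotate (G p₂) _ _ _
  gaps-total p₁ = trans (rotate (G p₁) _ _ _) (rotate (G p₂) _ _ _)
  gaps-total p₀ = trans (rotate (G p₀) _ _ _) (trans (rotate (G p₁) _ _ _) (rotate (G p₂) _ _ _))

  three-gaps<a : ∀ σ → G σ + G (next σ) + G (next (next σ)) < a
  three-gaps<a σ = subst (G σ + G (next σ) + G (next (next σ)) <_) (gaps-total σ) (m<m+n _ z<s)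

  phase-transfer : ∀ p q σ → p ⟨ σ ⟩ → Agree p q (G σ + G (next σ)) → q ⟨ σ ⟩
  phase-transfer p q σ e agree with phase-of-mark q q-marked
    where
    q-marked : mark q ≡ true
    q-marked = trans (cong mark (sym (+-identityʳ q)))
                 (trans (sym (agree 0 z≤n)) (trans (cong mark (+-identityʳ p)) (mark-of-phase p σ e)))
  ... | τ , e′ = subst (λ υ → q ⟨ υ ⟩) (gaps-determine-phase τ σ (sym first-gap) (sym second-gap)) e′
    where
    first-gap : G σ ≡ G τ
    first-gap = gap-determined q τ (G σ) e′
      (next-mark-transfer p q (G σ) (agree-restrict p q (m≤m+n _ _) agree) (next-of-phase p σ e))
    q′⟨⟩ : (q + G σ) ⟨ next τ ⟩
    q′⟨⟩ = subst (λ d → (q + d) ⟨ next τ ⟩) (sym first-gap) (next-mark q τ e′)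
    second-gap : G (next σ) ≡ G (next τ)
    second-gap = gap-determined (q + G σ) (next τ) (G (next σ)) q′⟨⟩
      (next-mark-transfer (p + G σ) (q + G σ) (G (next σ)) (agree-shift p q (G σ) _ agree)
        (next-of-phase (p + G σ) (next σ) (next-mark p σ e)))

  rigid : ∀ s s′ → Agree s s′ R₃ → ModEq a s s′
  rigid s s′ agree with first-mark s
  ... | σ , e , e<G , e⟨⟩ , _ =
    modEq-cancelʳ a s s′ e (%-modEq a (s + e) (s′ + e)
      (trans e⟨⟩ (sym (phase-transfer (s + e) (s′ + e) (next σ) e⟨⟩
        (agree-shift s s′ e _ (agree-restrict s s′ fits agree))))))
    where
    fits : e + (G (next σ) + G (next (next σ))) ≤ R₃
    fits = <⇒≤pred (begin-strict
      e + (G (next σ) + G (next (next σ)))    <⟨ +-monoˡ-< _ e<G ⟩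
      G σ + (G (next σ) + G (next (next σ)))  ≡⟨ +-assoc (G σ) _ _ ⟨
      G σ + G (next σ) + G (next (next σ))    <⟨ three-gaps<a σ ⟩
      a                                       ∎)
      where open ≤-Reasoning

  first-mark-in-window : ∀ s L e → 0 < L → e < L + L →
    (∀ j → j < L → mark (s + j) ≡ mark (s + L + j)) →
    mark (s + e) ≡ true → (∀ t → t < e → mark (s + t) ≡ false) → e < L
  first-mark-in-window s L e 0<L e<2L period marked before with e <? L
  ... | yes e<L = e<L
  ... | no e≮L = ⊥-elim (true≢false (begin
    true              ≡⟨ marked ⟨
    mark (s + e)      ≡⟨ cong (λ i → mark (s + i)) (m+[n∸m]≡n L≤e) ⟨
    mark (s + (L + j)) ≡⟨ cong mark (+-assoc s L j) ⟨
    mark (s + L + j)  ≡⟨ period j j<L ⟨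
    mark (s + j)      ≡⟨ before j (∸-monoʳ-< 0<L L≤e) ⟩
    false             ∎))
    where
    open ≡-Reasoning
    L≤e = ≮⇒≥ e≮L
    j = e ∸ L
    j<L : j < L
    j<L = +-cancelˡ-< L j L (subst (_< L + L) (sym (m+[n∸m]≡n L≤e)) e<2L)

  module PeriodicWindow (s L : ℕ) (period : ∀ j → j < L → mark (s + j) ≡ mark (s + L + j))
                        (e : ℕ) (e<L : e < L) (τ : Phase) (p⟨⟩ : (s + e) ⟨ τ ⟩)
                        (before : ∀ t → t < e → mark (s + t) ≡ false) where
    p = s + e

    shifted : ∀ t → e + t < L → mark (p + t) ≡ mark (p + L + t)
    shifted t h = begin
      mark (s + e + t)       ≡⟨ cong mark (+-assoc s e t) ⟩
      mark (s + (e + t))     ≡⟨ period (e + t) h ⟩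
      mark (s + L + (e + t)) ≡⟨ cong mark (regroup s L e t) ⟩
      mark (s + e + L + t)   ∎
      where
      open ≡-Reasoning
      regroup : ∀ s L e t → s + L + (e + t) ≡ s + e + L + t
      regroup = solve-∀

    agree-copy : ∀ d → e + d < L → Agree p (p + L) d
    agree-copy d h t t≤d = shifted t (≤-<-trans (+-monoʳ-≤ e t≤d) h)

    copy-marked : mark (p + L) ≡ true
    copy-marked = trans (cong mark (x+y+z≡x+z+y s e L)) (trans (sym (period e e<L)) (mark-of-phase p τ p⟨⟩))

    beyond : ∀ t → t < L → L ≤ e + t → mark (p + t) ≡ false
    beyond t t<L L≤e+t = begin
      mark (s + e + t)      ≡⟨ cong mark (trans (+-assoc s e t) (cong (s +_) (sym (m+[n∸m]≡n L≤e+t)))) ⟩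
      mark (s + (L + j))    ≡⟨ cong mark (+-assoc s L j) ⟨
      mark (s + L + j)      ≡⟨ period j (<-trans j<e e<L) ⟨
      mark (s + j)          ≡⟨ before j j<e ⟩
      false                 ∎
      where
      open ≡-Reasoning
      j = e + t ∸ L
      j<e : j < e
      j<e = +-cancelʳ-< L j e (subst (_< e + L) (sym (m∸n+n≡m L≤e+t)) (+-monoʳ-< e t<L))

    -- If the gap after p reaches past the window, the copy is the next mark:
    -- L would be a gap length.
    long-gap : L ≤ e + G τ → G τ ≡ L
    long-gap L≤ = sym (gap-determined p τ L p⟨⟩ (≤-<-trans z≤n e<L , copy-marked , inside))
      where
      inside : ∀ t → 0 < t → t < L → mark (p + t) ≡ false
      inside t 0<t t<L with e + t <? L
      ... | yes e+t<L = unmarked-after p τ t p⟨⟩ 0<t (+-cancelˡ-< e t (G τ) (<-≤-trans e+t<L L≤))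
      ... | no e+t≮L  = beyond t t<L (≮⇒≥ e+t≮L)

    -- If two gaps fit in the window, p + L has the phase of p.
    two-gaps : e + G τ + G (next τ) < L → a ∣ L
    two-gaps h = %-stable⇒∣ a p L (trans (phase-transfer p (p + L) τ p⟨⟩ agree) (sym p⟨⟩))
      where
      agree : Agree p (p + L) (G τ + G (next τ))
      agree = agree-copy _ (subst (_< L) (+-assoc e (G τ) _) h)

    -- Otherwise the copy p + L is the mark after p + G τ; then the gaps of
    -- phases τ and next (next τ) coincide, which is impossible.
    one-gap : e + G τ < L → L ≤ e + G τ + G (next τ) → ⊥
    one-gap h L≤ = gap-two-ahead τ (gap-determined (p + L) (next (next τ)) (G τ) copy⟨⟩
                     (next-mark-transfer p (p + L) (G τ) (agree-copy (G τ) h) (next-of-phase p τ p⟨⟩)))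
      where
      p′ = p + G τ
      Gτ<L : G τ < L
      Gτ<L = ≤-<-trans (m≤n+m (G τ) e) h
      d = L ∸ G τ
      p′+d : p′ + d ≡ p + L
      p′+d = trans (+-assoc p (G τ) d) (cong (p +_) (m+[n∸m]≡n (<⇒≤ Gτ<L)))
      inside : ∀ t → 0 < t → t < d → mark (p′ + t) ≡ false
      inside t 0<t t<d with e + G τ + t <? L
      ... | yes in-window = unmarked-after p′ (next τ) t (next-mark p τ p⟨⟩) 0<t
                              (+-cancelˡ-< (e + G τ) t _ (<-≤-trans in-window L≤))
      ... | no out = trans (cong mark (+-assoc p (G τ) t))
                       (beyond (G τ + t) (subst (G τ + t <_) (m+[n∸m]≡n (<⇒≤ Gτ<L)) (+-monoʳ-< (G τ) t<d))
                         (subst (L ≤_) (+-assoc e (G τ) t) (≮⇒≥ out)))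
      d≡ : d ≡ G (next τ)
      d≡ = gap-determined p′ (next τ) d (next-mark p τ p⟨⟩)
             (m<n⇒0<n∸m Gτ<L , trans (cong mark p′+d) copy-marked , inside)
      copy⟨⟩ : (p + L) ⟨ next (next τ) ⟩
      copy⟨⟩ = subst (_⟨ next (next τ) ⟩) (trans (cong (p′ +_) (sym d≡)) p′+d) (next-mark p′ (next τ) (next-mark p τ p⟨⟩))

    divisible : (∀ σ → G σ ≢ L) → a ∣ L
    divisible gap≢L with e + G τ <? L
    ... | no out = ⊥-elim (gap≢L τ (long-gap (≮⇒≥ out)))
    ... | yes h with e + G τ + G (next τ) <? L
    ... | yes h′ = two-gaps h′
    ... | no out = ⊥-elim (one-gap h (≮⇒≥ out))

  periodic-window : ∀ s L → (∀ σ → G σ ≢ L) → (∀ σ → G σ ≤ L + L) →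
    (∀ j → j < L → mark (s + j) ≡ mark (s + L + j)) → a ∣ L
  periodic-window s zero    _     _     _      = a ∣0
  periodic-window s L@(suc _) gap≢L gap≤2L period with first-mark s
  ... | σ , e , e<G , p⟨⟩ , before =
    PeriodicWindow.divisible s L period e e<L (next σ) p⟨⟩ before gap≢L
    where
    e<L : e < L
    e<L = first-mark-in-window s L e z<s (<-≤-trans e<G (gap≤2L σ)) period
            (mark-of-phase (s + e) (next σ) p⟨⟩) before

nonzero : ℕ → Bool
nonzero zero    = false
nonzero (suc _) = true

module Image (x y z : ℕ) (x≢y : x ≢ y) (x≢z : x ≢ z) (y≢z : y ≢ z) where

  open Markers x y z x≢y x≢z y≢z

  tail₁ tail₂ tail₃ φ : ℕ → Word
  tail₃ c = replicate x 0 ++ suc c ∷ []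
  tail₂ c = replicate z 0 ++ 1 ∷ tail₃ c
  tail₁ c = replicate y 0 ++ 1 ∷ tail₂ c
  φ c     = replicate x 0 ++ 1 ∷ tail₁ c

  length-φ : Uniform a φ
  length-φ c = begin
    length (φ c)                                  ≡⟨ length-prefix x (1 ∷ tail₁ c) ⟩
    x + suc (length (tail₁ c))                    ≡⟨ cong (λ n → x + suc n) (length-prefix y (1 ∷ tail₂ c)) ⟩
    x + suc (y + suc (length (tail₂ c)))          ≡⟨ cong (λ n → x + suc (y + suc n)) (length-prefix z (1 ∷ tail₃ c)) ⟩
    x + suc (y + suc (z + suc (length (tail₃ c)))) ≡⟨ cong (λ n → x + suc (y + suc (z + suc n))) (length-prefix x (suc c ∷ [])) ⟩
    x + suc (y + suc (z + suc (x + 1)))           ≡⟨ regroup x y z ⟩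
    a                                             ∎
    where
    open ≡-Reasoning
    length-prefix : ∀ m (l : Word) → length (replicate m 0 ++ l) ≡ m + length l
    length-prefix m l = trans (length-++ (replicate m 0)) (cong (_+ length l) (length-replicate m))
    regroup : ∀ x y z → x + suc (y + suc (z + suc (x + 1))) ≡ suc (x + suc y + suc z + suc x)
    regroup = solve-∀

  after-R₀ : ∀ c n → at (φ c) (R₀ + suc n) ≡ at (tail₁ c) n
  after-R₀ c n = at-after-replicate x 0 (1 ∷ tail₁ c) (suc n)

  after-R₁ : ∀ c n → at (φ c) (R₁ + suc n) ≡ at (tail₂ c) n
  after-R₁ c n = begin
    at (φ c) (x + suc y + suc n)     ≡⟨ cong (at (φ c)) (+-assoc x (suc y) (suc n)) ⟩
    at (φ c) (R₀ + suc (y + suc n))  ≡⟨ after-R₀ c (y + suc n) ⟩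
    at (tail₁ c) (y + suc n)         ≡⟨ at-after-replicate y 0 (1 ∷ tail₂ c) (suc n) ⟩
    at (tail₂ c) n                   ∎
    where open ≡-Reasoning

  after-R₂ : ∀ c n → at (φ c) (R₂ + suc n) ≡ at (tail₃ c) n
  after-R₂ c n = begin
    at (φ c) (R₁ + suc z + suc n)    ≡⟨ cong (at (φ c)) (+-assoc R₁ (suc z) (suc n)) ⟩
    at (φ c) (R₁ + suc (z + suc n))  ≡⟨ after-R₁ c (z + suc n) ⟩
    at (tail₂ c) (z + suc n)         ≡⟨ at-after-replicate z 0 (1 ∷ tail₃ c) (suc n) ⟩
    at (tail₃ c) n                   ∎
    where open ≡-Reasoning

  last-letter : ∀ c → at (φ c) R₃ ≡ suc c
  last-letter c = trans (after-R₂ c x) (subst (λ n → at (tail₃ c) n ≡ suc c) (+-identityʳ x)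
                    (at-after-replicate x 0 (suc c ∷ []) 0))

  last-injective : ∀ c c′ → at (φ c) R₃ ≡ at (φ c′) R₃ → c ≡ c′
  last-injective c c′ e = suc-injective (trans (sym (last-letter c)) (trans e (last-letter c′)))

  nonzero-at-marks : ∀ c σ → nonzero (at (φ c) (R σ)) ≡ true
  nonzero-at-marks c p₀ = cong nonzero (subst (λ n → at (φ c) n ≡ 1) (+-identityʳ x) (at-after-replicate x 0 (1 ∷ tail₁ c) 0))
  nonzero-at-marks c p₁ = cong nonzero (trans (after-R₀ c y) (subst (λ n → at (tail₁ c) n ≡ 1) (+-identityʳ y)
                            (at-after-replicate y 0 (1 ∷ tail₂ c) 0)))
  nonzero-at-marks c p₂ = cong nonzero (trans (after-R₁ c z) (subst (λ n → at (tail₂ c) n ≡ 1) (+-identityʳ z)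
                            (at-after-replicate z 0 (1 ∷ tail₃ c) 0)))
  nonzero-at-marks c p₃ = cong nonzero (last-letter c)

  zero-in-gaps : ∀ c σ t → 0 < t → t < G σ → at (φ c) ((R σ + t) % a) ≡ 0
  zero-in-gaps c p₀ (suc t) _ (s≤s t<y) = trans (cong (at (φ c)) (m<n⇒m%n≡m (<-trans (+-monoʳ-< R₀ (s≤s t<y)) (R<a p₁))))
                                            (trans (after-R₀ c t) (at-replicate y 0 _ t t<y))
  zero-in-gaps c p₁ (suc t) _ (s≤s t<z) = trans (cong (at (φ c)) (m<n⇒m%n≡m (<-trans (+-monoʳ-< R₁ (s≤s t<z)) (R<a p₂))))
                                            (trans (after-R₁ c t) (at-replicate z 0 _ t t<z))
  zero-in-gaps c p₂ (suc t) _ (s≤s t<x) = trans (cong (at (φ c)) (m<n⇒m%n≡m (<-trans (+-monoʳ-< R₂ (s≤s t<x)) (R<a p₃))))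
                                            (trans (after-R₂ c t) (at-replicate x 0 _ t t<x))
  zero-in-gaps c p₃ (suc t) _ (s≤s t<x) = trans (cong (at (φ c)) (wrap t (<-trans t<x (R<a p₀))))
                                            (at-replicate x 0 _ t t<x)

  φ-pattern : ∀ c ρ → ρ < a → nonzero (at (φ c) ρ) ≡ does (marked? ρ)
  φ-pattern c ρ ρ<a with classify ρ ρ<a
  ... | inj₁ (σ , refl) = trans (nonzero-at-marks c σ) (sym (dec-true (marked? (R σ)) (σ , refl)))
  ... | inj₂ (σ , t , 0<t , t<G , refl) =
    trans (cong nonzero (zero-in-gaps c σ t 0<t t<G)) (sym (dec-false (marked? _) (in-gap-unmarked σ t 0<t t<G)))

  image-pattern : ∀ w n → n < length (apply φ w) → nonzero (at (apply φ w) n) ≡ mark n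
  image-pattern w n n<W = begin
    nonzero (at (apply φ w) n)                  ≡⟨ cong (λ i → nonzero (at (apply φ w) i)) n≡ ⟩
    nonzero (at (apply φ w) (n / a * a + n % a)) ≡⟨ cong nonzero (at-apply φ length-φ w (n / a) (n % a) q<w (m%n<n n a)) ⟩
    nonzero (at (φ (at w (n / a))) (n % a))      ≡⟨ φ-pattern _ (n % a) (m%n<n n a) ⟩
    mark n                                      ∎
    where
    open ≡-Reasoning
    n≡ : n ≡ n / a * a + n % a
    n≡ = trans (m≡m%n+[m/n]*n n a) (+-comm (n % a) _)
    q<w : n / a < length w
    q<w = m<n*o⇒m/o<n (subst (n <_) (length-apply φ length-φ w) n<W)

  occurrence-pattern : ∀ w u v z → apply φ w ≡ u ++ v ++ z →
    ∀ i → i < length v → mark (length u + i) ≡ nonzero (at v i)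
  occurrence-pattern w u v z W≡ i i<v =
    trans (sym (image-pattern w _ (<-≤-trans (+-monoʳ-< (length u) i<v) (occurrence-end u v z W≡))))
          (cong nonzero (at-occurrence u v z W≡ i i<v))

  Fits : Word → Fin a → Set
  Fits v ρ = ∀ (i : Fin a) → mark (toℕ ρ + toℕ i) ≡ nonzero (at v (toℕ i))

  fits? : ∀ v → Dec (Σ (Fin a) (Fits v))
  fits? v = any? λ ρ → all? λ i → mark (toℕ ρ + toℕ i) Bool.≟ nonzero (at v (toℕ i))

  -- φ locates words of length a: all occurrences of v share the residue of
  -- any ρ that fits v (by rigidity), and if no ρ fits, v does not occur.
  locates : Locates a φ a
  locates v |v|≡a with fits? v
  ... | yes (ρ , fits) = toℕ ρ , λ w u z W≡ → rigid (length u) (toℕ ρ) λ i i≤R₃ →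
    trans (occurrence-pattern w u v z W≡ i (subst (i <_) (sym |v|≡a) (s≤s i≤R₃)))
          (sym (subst (λ j → mark (toℕ ρ + j) ≡ nonzero (at v j)) (toℕ-fromℕ< (s≤s i≤R₃)) (fits (fromℕ< (s≤s i≤R₃)))))
  ... | no none = 0 , λ w u z W≡ → ⊥-elim (none (fromℕ< (m%n<n (length u) a) , λ i →
    trans (mark-cong (toℕ (fromℕ< (m%n<n (length u) a)) + toℕ i) (length u + toℕ i)
            (trans (cong (λ ρ → (ρ + toℕ i) % a) (toℕ-fromℕ< (m%n<n (length u) a)))
                   (%-shift a (length u % a) (length u) (toℕ i) (m%n%n≡m%n (length u) a))))
          (occurrence-pattern w u v z W≡ (toℕ i) (subst (toℕ i <_) (sym |v|≡a) (toℕ<n i)))))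

  module PowerFreeness (b r : ℕ) (a≡b+r : a ≡ b + r) (r<b : r < b)
                       (gap≢r : ∀ σ → G σ ≢ r) (gap<2r : ∀ σ → G σ < r + r) (coprime : Coprime a b) where

    multiple-split : ∀ K → K * a ≡ K * b + K * r
    multiple-split K = trans (cong (K *_) a≡b+r) (*-distribˡ-+ K b r)

    gap≢multiple : ∀ K → 0 < K → ∀ σ → G σ ≢ K * r
    gap≢multiple (suc zero)    _ σ e = gap≢r σ (trans e (+-identityʳ r))
    gap≢multiple (suc (suc k)) _ σ   = <⇒≢ (<-≤-trans (gap<2r σ) (+-monoʳ-≤ r (m≤m+n r (k * r))))

    -- A repetition of period Kb and excess Kr in an image makes its
    -- pattern L-periodic on a window of length 2L for L = Kr, whence a ∣ Kr.
    image-repetition : ∀ w o K → 0 < K → Repetition (apply φ w) o (K * b) (K * r) → a ∣ K * r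
    image-repetition w o K 0<K (bound , per) =
      periodic-window (o + K * b) (K * r) gap≢Kr gap≤2Kr period
      where
      W = apply φ w
      in-W : ∀ j → j < K * r → o + K * b + j < length W
      in-W j j<Kr = <-≤-trans (+-monoʳ-< (o + K * b) j<Kr) bound
      period : ∀ j → j < K * r → mark (o + K * b + j) ≡ mark (o + K * b + K * r + j)
      period j j<Kr = begin
        mark (o + K * b + j)              ≡⟨ image-pattern w _ (in-W j j<Kr) ⟨
        nonzero (at W (o + K * b + j))    ≡⟨ cong nonzero (per j j<Kr) ⟨
        nonzero (at W (o + j))            ≡⟨ image-pattern w _ (≤-<-trans (+-monoˡ-≤ j (m≤m+n o (K * b))) (in-W j j<Kr)) ⟩
        mark (o + j)                      ≡⟨ mark-periodic (o + j) K ⟨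
        mark (o + j + K * a)              ≡⟨ cong mark (trans (cong (o + j +_) (multiple-split K)) (regroup o j (K * b) (K * r))) ⟩
        mark (o + K * b + K * r + j)      ∎
        where
        open ≡-Reasoning
        regroup : ∀ o j p q → o + j + (p + q) ≡ o + p + q + j
        regroup = solve-∀
      r≤Kr : r ≤ K * r
      r≤Kr = subst (_≤ K * r) (*-identityˡ r) (*-monoˡ-≤ r 0<K)
      gap≢Kr : ∀ σ → G σ ≢ K * r
      gap≢Kr = gap≢multiple K 0<K
      gap≤2Kr : ∀ σ → G σ ≤ K * r + K * r
      gap≤2Kr σ = <⇒≤ (<-≤-trans (gap<2r σ) (+-mono-≤ r≤Kr r≤Kr))

    -- a ∣ Kr forces a ∣ K, because a ∣ Ka = Kb + Kr and gcd(a, b) = 1.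
    divides-multiplier : ∀ K → a ∣ K * r → a ∣ K
    divides-multiplier K a∣Kr = coprime-divisor coprime (subst (a ∣_) (*-comm K b) a∣Kb)
      where
      a∣Kb : a ∣ K * b
      a∣Kb = ∣m+n∣m⇒∣n (subst (a ∣_) (trans (multiple-split K) (+-comm (K * b) (K * r))) (n∣m*n K)) a∣Kr

    -- An (a/b)-power in φ(w) is a repetition of period Kb, excess Kr; then
    -- K = k′a and desubstitution gives a repetition of period k′b, excess
    -- k′r in w, i.e. an (a/b)-power in w.
    power-free : PowerFreeMorphism a b φ
    power-free w free v v-factor v-power
      with power⇒repetition a≡b+r r<b (apply φ w) v v-factor v-power
    ... | k , o , rep with divides-multiplier (suc k) (image-repetition w o (suc k) z<s rep)
    ... | divides zero ()
    ... | divides k′@(suc k″) K≡ =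
      repetition⇒power a≡b+r r<b w (o / a) k″
        (desubstitute R₃ φ length-φ last-injective w o (k′ * b) (k′ * r) rep′) free
      where
      swap : ∀ n → suc k * n ≡ k′ * n * a
      swap n = trans (cong (_* n) K≡) (x*y*z≡x*z*y k′ a n)
      rep′ : Repetition (apply φ w) o (k′ * b * a) (k′ * r * a)
      rep′ = subst₂ (Repetition (apply φ w) o) (swap b) (swap r) rep

-- For 6/5 < a/b < 5/4 the numbers c = 5a − 6b and d = 5b − 4a are positive
-- and a = 5c + 6d, b = 4c + 5d.
ratio-coordinates : ∀ a b → 6 * b < 5 * a → 4 * a < 5 * b →
  Σ ℕ λ c → Σ ℕ λ d → 0 < c × 0 < d × a ≡ 5 * c + 6 * d × b ≡ 4 * c + 5 * d
ratio-coordinates a b 6b<5a 4a<5b = c , d , m<n⇒0<n∸m 6b<5a , m<n⇒0<n∸m 4a<5b , a≡ , b≡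
  where
  c = 5 * a ∸ 6 * b
  d = 5 * b ∸ 4 * a
  c-def : c + 6 * b ≡ 5 * a
  c-def = m∸n+n≡m (<⇒≤ 6b<5a)
  d-def : d + 4 * a ≡ 5 * b
  d-def = m∸n+n≡m (<⇒≤ 4a<5b)
  a≡ : a ≡ 5 * c + 6 * d
  a≡ = +-cancelʳ-≡ (24 * a) a (5 * c + 6 * d) (begin
    a + 24 * a                ≡⟨ ring₁ a ⟩
    5 * (5 * a)               ≡⟨ cong (5 *_) c-def ⟨
    5 * (c + 6 * b)           ≡⟨ ring₂ c b ⟩
    5 * c + 6 * (5 * b)       ≡⟨ cong (λ t → 5 * c + 6 * t) d-def ⟨
    5 * c + 6 * (d + 4 * a)   ≡⟨ ring₃ c d a ⟩
    5 * c + 6 * d + 24 * a    ∎)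
    where
    open ≡-Reasoning
    ring₁ : ∀ a → a + 24 * a ≡ 5 * (5 * a)
    ring₁ = solve-∀
    ring₂ : ∀ c b → 5 * (c + 6 * b) ≡ 5 * c + 6 * (5 * b)
    ring₂ = solve-∀
    ring₃ : ∀ c d a → 5 * c + 6 * (d + 4 * a) ≡ 5 * c + 6 * d + 24 * a
    ring₃ = solve-∀
  b≡ : b ≡ 4 * c + 5 * d
  b≡ = *-cancelˡ-≡ b (4 * c + 5 * d) 5 (begin
    5 * b                          ≡⟨ d-def ⟨
    d + 4 * a                      ≡⟨ cong (λ t → d + 4 * t) a≡ ⟩
    d + 4 * (5 * c + 6 * d)        ≡⟨ ring c d ⟩
    5 * (4 * c + 5 * d)            ∎)
    where
    open ≡-Reasoning
    ring : ∀ c d → d + 4 * (5 * c + 6 * d) ≡ 5 * (4 * c + 5 * d)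
    ring = solve-∀

exponent : ∀ m k n → m ≡ n + k → 0 < n → suc (m ∸ k ∸ 1) ≡ n
exponent m k (suc n) m≡ _ = cong (λ t → suc (t ∸ 1)) (trans (cong (_∸ k) m≡) (m+n∸n≡m (suc n) k))

run-length-x : ∀ c d → 0 < c → suc (6 * (5 * c + 6 * d) ∸ 7 * (4 * c + 5 * d) ∸ 1) ≡ c + c + d
run-length-x c d 0<c = exponent _ _ (c + c + d) (ring c d) (<-≤-trans 0<c (≤-trans (m≤m+n c c) (m≤m+n (c + c) d)))
  where
  ring : ∀ c d → 6 * (5 * c + 6 * d) ≡ c + c + d + 7 * (4 * c + 5 * d)
  ring = solve-∀

run-length-y : ∀ c d → 0 < c → suc (4 * (4 * c + 5 * d) ∸ 3 * (5 * c + 6 * d) ∸ 1) ≡ c + d + d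
run-length-y c d 0<c = exponent _ _ (c + d + d) (ring c d) (<-≤-trans 0<c (≤-trans (m≤m+n c d) (m≤m+n (c + d) d)))
  where
  ring : ∀ c d → 4 * (4 * c + 5 * d) ≡ c + d + d + 3 * (5 * c + 6 * d)
  ring = solve-∀

run-length-z : ∀ c d → 0 < d → suc (10 * (4 * c + 5 * d) ∸ 8 * (5 * c + 6 * d) ∸ 1) ≡ d + d
run-length-z c d 0<d = exponent _ _ (d + d) (ring c d) (<-≤-trans 0<d (m≤m+n d d))
  where
  ring : ∀ c d → 10 * (4 * c + 5 * d) ≡ d + d + 8 * (5 * c + 6 * d)
  ring = solve-∀

theorem-in-coordinates : ∀ c d → 0 < c → 0 < d → c ≢ d → c + c ≢ d →
  Coprime (5 * c + 6 * d) (4 * c + 5 * d) →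
  Uniform (5 * c + 6 * d) (φab (5 * c + 6 * d) (4 * c + 5 * d)) ×
  Locates (5 * c + 6 * d) (φab (5 * c + 6 * d) (4 * c + 5 * d)) (5 * c + 6 * d) ×
  PowerFreeMorphism (5 * c + 6 * d) (4 * c + 5 * d) (φab (5 * c + 6 * d) (4 * c + 5 * d))
theorem-in-coordinates c d 0<c 0<d c≢d 2c≢d coprime =
  subst (λ t → Uniform t I.φ × Locates t I.φ t × PowerFreeMorphism t b I.φ) period≡
    (I.length-φ , I.locates , P.power-free)
  where
  a = 5 * c + 6 * d
  b = 4 * c + 5 * d
  r = c + d
  X = 6 * a ∸ 7 * b ∸ 1
  Y = 4 * b ∸ 3 * a ∸ 1
  Z = 10 * b ∸ 8 * a ∸ 1
  suc-X : suc X ≡ c + c + d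
  suc-X = run-length-x c d 0<c
  suc-Y : suc Y ≡ c + d + d
  suc-Y = run-length-y c d 0<c
  suc-Z : suc Z ≡ d + d
  suc-Z = run-length-z c d 0<d
  X≢Y : X ≢ Y
  X≢Y e = c≢d (+-cancelˡ-≡ c c d (+-cancelʳ-≡ d (c + c) (c + d) (trans (sym suc-X) (trans (cong suc e) suc-Y))))
  X≢Z : X ≢ Z
  X≢Z e = 2c≢d (+-cancelʳ-≡ d (c + c) d (trans (sym suc-X) (trans (cong suc e) suc-Z)))
  Y≢Z : Y ≢ Z
  Y≢Z e = <⇒≢ 0<c (sym (+-cancelʳ-≡ d c 0 (+-cancelʳ-≡ d (c + d) d (trans (sym suc-Y) (trans (cong suc e) suc-Z)))))
  module M = Markers X Y Z X≢Y X≢Z Y≢Z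
  module I = Image X Y Z X≢Y X≢Z Y≢Z
  ring-a : ∀ c d → c + c + d + (c + d + d) + (d + d) + (c + c + d) ≡ 5 * c + 6 * d
  ring-a = solve-∀
  period≡ : M.a ≡ a
  period≡ = trans (cong₂ (λ s t → s + suc Y + suc Z + t) suc-X suc-X)
              (trans (cong₂ (λ s t → c + c + d + s + t + (c + c + d)) suc-Y suc-Z) (ring-a c d))
  ring-b : ∀ c d → 5 * c + 6 * d ≡ 4 * c + 5 * d + (c + d)
  ring-b = solve-∀
  a≡b+r : M.a ≡ b + r
  a≡b+r = trans period≡ (ring-b c d)
  ring-r : ∀ c d → 4 * c + 5 * d ≡ c + d + (3 * c + 4 * d)
  ring-r = solve-∀
  r<b : r < b
  r<b = subst (r <_) (sym (ring-r c d)) (m<m+n r (<-≤-trans 0<c (≤-trans (m≤m+n c (2 * c)) (m≤m+n (3 * c) (4 * d)))))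
  gap≢r : ∀ σ → M.G σ ≢ r
  gap≢r M.p₀ e = <⇒≢ 0<d (sym (+-cancelˡ-≡ (c + d) d 0 (trans (sym suc-Y) (trans e (sym (+-identityʳ r))))))
  gap≢r M.p₁ e = c≢d (sym (+-cancelʳ-≡ d d c (trans (sym suc-Z) e)))
  gap≢r M.p₂ e = <⇒≢ 0<c (sym (+-cancelˡ-≡ c c 0 (trans (+-cancelʳ-≡ d (c + c) c (trans (sym suc-X) e)) (sym (+-identityʳ c)))))
  gap≢r M.p₃ e = gap≢r M.p₂ e
  second-gap<2r : c + d + d < r + r
  second-gap<2r = +-monoʳ-< (c + d) (m<n+m d 0<c)
  gap<2r : ∀ σ → M.G σ < r + r
  gap<2r M.p₀ = subst (_< r + r) (sym suc-Y) second-gap<2r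
  gap<2r M.p₁ = subst (_< r + r) (sym suc-Z) (<-trans (+-monoˡ-< d (m<n+m d 0<c)) second-gap<2r)
  gap<2r M.p₂ = subst (_< r + r) (sym (trans suc-X (+-assoc c c d))) (+-monoˡ-< (c + d) (m<m+n c 0<d))
  gap<2r M.p₃ = gap<2r M.p₂
  module P = I.PowerFreeness b r a≡b+r r<b gap≢r gap<2r (subst (λ t → Coprime t b) (sym period≡) coprime)

ratio-11/9 : ∀ {a b} c d → a ≡ 5 * c + 6 * d → b ≡ 4 * c + 5 * d → 9 * a ≢ 11 * b → c ≢ d
ratio-11/9 {a} {b} c d a≡ b≡ 9a≢11b c≡d = 9a≢11b (begin
  9 * a                 ≡⟨ cong (9 *_) (trans a≡ (cong (λ t → 5 * c + 6 * t) (sym c≡d))) ⟩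
  9 * (5 * c + 6 * c)   ≡⟨ ratio c ⟩
  11 * (4 * c + 5 * c)  ≡⟨ cong (11 *_) (trans b≡ (cong (λ t → 4 * c + 5 * t) (sym c≡d))) ⟨
  11 * b                ∎)
  where
  open ≡-Reasoning
  ratio : ∀ c → 9 * (5 * c + 6 * c) ≡ 11 * (4 * c + 5 * c)
  ratio = solve-∀

ratio-17/14 : ∀ {a b} c d → a ≡ 5 * c + 6 * d → b ≡ 4 * c + 5 * d → 14 * a ≢ 17 * b → c + c ≢ d
ratio-17/14 {a} {b} c d a≡ b≡ 14a≢17b 2c≡d = 14a≢17b (begin
  14 * a                      ≡⟨ cong (14 *_) (trans a≡ (cong (λ t → 5 * c + 6 * t) (sym 2c≡d))) ⟩
  14 * (5 * c + 6 * (c + c))  ≡⟨ ratio c ⟩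
  17 * (4 * c + 5 * (c + c))  ≡⟨ cong (17 *_) (trans b≡ (cong (λ t → 4 * c + 5 * t) (sym 2c≡d))) ⟨
  17 * b                      ∎)
  where
  open ≡-Reasoning
  ratio : ∀ c → 14 * (5 * c + 6 * (c + c)) ≡ 17 * (4 * c + 5 * (c + c))
  ratio = solve-∀

theorem4p8 : (a b : ℕ) → 0 < a → 0 < b → Coprime a b →
    6 * b < 5 * a → 4 * a < 5 * b → 9 * a ≢ 11 * b → 14 * a ≢ 17 * b →
    Uniform a (φab a b) × Locates a (φab a b) a × PowerFreeMorphism a b (φab a b)
theorem4p8 a b _ _ coprime 6b<5a 4a<5b 9a≢11b 14a≢17b = from-coordinates (ratio-coordinates a b 6b<5a 4a<5b)
  where
  Goal : ℕ → ℕ → Set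
  Goal a b = Uniform a (φab a b) × Locates a (φab a b) a × PowerFreeMorphism a b (φab a b)
  from-coordinates : (Σ ℕ λ c → Σ ℕ λ d → 0 < c × 0 < d × a ≡ 5 * c + 6 * d × b ≡ 4 * c + 5 * d) → Goal a b
  from-coordinates (c , d , 0<c , 0<d , a≡ , b≡) =
    subst₂ Goal (sym a≡) (sym b≡)
      (theorem-in-coordinates c d 0<c 0<d (ratio-11/9 c d a≡ b≡ 9a≢11b) (ratio-17/14 c d a≡ b≡ 14a≢17b)
        (subst₂ Coprime a≡ b≡ coprime))
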